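{- Let $I=\{B\subseteq\{l,r\}^\star: B\text{ has no infinite antichain}\}$. Then the set $f(I)$ is an $F_\sigma$-subset of $\{0,1\}^\omega$.
   Context: An antichain in $\{l,r\}^\star$ is a set of words pairwise incomparable for the prefix order. $f:\{l,r\}^\star\to\mathbb{N}$ is the bijection enumerating words by increasing length and, within a given length, lexicographically with $l<r$ ($f(\varepsilon)=0$, $f(l)=1$, $f(r)=2$, $f(ll)=3$, $f(lr)=4$, ...); $f$ also denotes the induced bijection $\mathcal{P}(\{l,r\}^\star)\to\mathcal{P}(\mathbb{N})$, $B\mapsto f[B]$. $\mathcal{P}(\mathbb{N})$ is identified with the Cantor space $\{0,1\}^\omega$ (with the product/prefix-metric topology) by $P\mapsto x_P$ where $x_P(i)=1$ iff $i-1\in P$ ($i\geq 1$). An $F_\sigma$-set is a countable union of closed sets. -}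

module Defs where

open import Level using (Level; 0ℓ) renaming (suc to lsuc)
open import Data.Nat using (ℕ; zero; suc; _+_; _*_; _<_)
open import Data.Bool using (Bool; true; false)
open import Data.List using (List; []; _∷_; _++_; foldl)
open import Data.Product using (Σ; ∃; ∃-syntax; _×_; _,_; proj₁)
open import Relation.Nullary using (¬_)
open import Relation.Binary.PropositionalEquality using (_≡_; _≢_)
open import Function.Bundles using (_⇔_)
open import Function.Definitions using (Injective)

-- The alphabet {l, r} and words {l,r}^⋆ (head of the list = first letter).
data Letter : Set where
  l r : Letter

Word : Set
Word = List Letter

_≼_ : Word → Word → Set
u ≼ v = ∃[ w ] (u ++ w ≡ v)

Incomparable : Word → Word → Set
Incomparable u v = ¬ (u ≼ v) × ¬ (v ≼ u)

WordSet : Set₁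
WordSet = Word → Set

IsAntichain : WordSet → Set
IsAntichain A = ∀ u v → A u → A v → u ≢ v → Incomparable u v

IsInfinite : WordSet → Set
IsInfinite A = Σ (ℕ → Σ Word A) Injective′
  where
  Injective′ : (ℕ → Σ Word A) → Set
  Injective′ g = ∀ i j → proj₁ (g i) ≡ proj₁ (g j) → i ≡ j

HasInfiniteAntichain : WordSet → Set₁
HasInfiniteAntichain B =
  Σ WordSet λ A → (∀ w → A w → B w) × IsAntichain A × IsInfinite A

I : WordSet → Set₁
I B = ¬ HasInfiniteAntichain B

-- The enumeration f : {l,r}^⋆ → ℕ (by length, then lexicographic, l < r):
-- f(ε) = 0 and f(w d) = 2 f(w) + 1 + [d = r].
bit : Letter → ℕ
bit l = 0
bit r = 1

f : Word → ℕ
f = foldl (λ n d → 2 * n + 1 + bit d) 0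

image : WordSet → ℕ → Set
image B n = ∃[ w ] (B w × f w ≡ n)

-- Cantor space {0,1}^ω; position k here is the paper's position k+1.
Cantor : Set
Cantor = ℕ → Bool

-- x codes P ⊆ ℕ (x = x_P): the paper's x_P(i) = 1 iff i-1 ∈ P.
Codes : Cantor → (ℕ → Set) → Set
Codes x P = ∀ k → (x k ≡ true) ⇔ P k

fI : Cantor → Set₁
fI x = Σ WordSet λ B → I B × Codes x (image B)

-- Topology of the Cantor space: basic open neighbourhoods are the cylinders
-- { y : y agrees with x on the first n positions } (balls of the prefix metric).
Agree : ℕ → Cantor → Cantor → Set
Agree n x y = ∀ i → i < n → y i ≡ x i

IsOpen : ∀ {ℓ} → (Cantor → Set ℓ) → Set ℓ
IsOpen U = ∀ x → U x → ∃[ n ] (∀ y → Agree n x y → U y)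

IsClosed : ∀ {ℓ} → (Cantor → Set ℓ) → Set ℓ
IsClosed C = IsOpen (λ x → ¬ C x)

IsFσ : ∀ {ℓ} → (Cantor → Set ℓ) → Set (lsuc ℓ)
IsFσ {ℓ} A = Σ (ℕ → Cantor → Set ℓ) λ C →
  (∀ k → IsClosed (C k)) × (∀ x → A x ⇔ (∃[ k ] C k x))

module Submission where

-- For x ∈ {0,1}^ω let decode x = { w : x (f w) = 1 }.  Since f is a
-- bijection, x ∈ f(I) iff decode x ∈ I.  A König-type argument on the binary
-- tree {l,r}^⋆ shows that B has no infinite antichain iff for some k it has
-- no antichain with k elements.  Hence f(I) = ⋃ₖ Cₖ with
-- Cₖ = { x : decode x has no antichain with k elements }, and Cₖ is closed:
-- a k-element antichain in decode x is a finite list of words, which stays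
-- an antichain in decode y for every y agreeing with x on their indices.

open import Defs
open import Level using (0ℓ; Lift; lift; lower) renaming (suc to lsuc)
open import Axiom.ExcludedMiddle using (ExcludedMiddle)
open import Axiom.DoubleNegationElimination using (DoubleNegationElimination; em⇒dne)
open import Data.Nat using (ℕ; zero; suc; _+_; _*_; _<_; _≤_; _≤′_; _≟_; _≤?_; z≤n; s≤s; ≤′-refl; ≤′-step)
open import Data.Nat.Properties
open import Data.Fin using (Fin; toℕ)
open import Data.Fin.Properties using (toℕ-injective)
open import Data.Bool using (true)
open import Data.List using (List; []; _∷_; _++_; _∷ʳ_; length; filter; tabulate)
open import Data.List.Properties
  using (foldl-∷ʳ; ++-identityʳ; ++-assoc; ++-cancelˡ; ∷-injectiveˡ; ∷-injectiveʳ; length-tabulate)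
open import Data.List.Reverse using (Reverse; []; _∶_∶ʳ_; reverseView)
open import Data.List.Relation.Unary.All as All using (All; []; _∷_)
import Data.List.Relation.Unary.All.Properties as All
open import Data.List.Relation.Unary.AllPairs using (AllPairs; []; _∷_)
import Data.List.Relation.Unary.AllPairs.Properties as AllPairs
open import Data.Product using (Σ; ∃-syntax; _×_; _,_; proj₁; proj₂; swap)
open import Data.Sum using (_⊎_; inj₁; inj₂; [_,_]′) renaming (map to ⊎-map)
open import Data.Empty using (⊥-elim)
open import Function using (id)
open import Function.Bundles using (_⇔_; mk⇔; Equivalence)
open import Function.Properties.Equivalence using () renaming (trans to ⇔-trans)
open import Relation.Binary.Definitions using (tri<; tri≈; tri>)
open import Relation.Nullary using (¬_; Dec; yes; no)
open import Relation.Nullary.Decidable using (map′)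
open import Relation.Unary using (Pred; Decidable)
open import Relation.Binary.PropositionalEquality
open ≡-Reasoning

-- f is a bijection {l,r}^⋆ → ℕ

f-∷ʳ : ∀ w d → f (w ∷ʳ d) ≡ suc (2 * f w + bit d)
f-∷ʳ w d = trans (foldl-∷ʳ (λ n e → 2 * n + 1 + bit e) 0 d w)
                 (cong (_+ bit d) (+-comm (2 * f w) 1))

digit-injective : ∀ m n a b → 2 * m + bit a ≡ 2 * n + bit b → m ≡ n × a ≡ b
digit-injective m n l l e = *-cancelˡ-≡ m n 2 (+-cancelʳ-≡ 0 (2 * m) (2 * n) e) , refl
digit-injective m n r r e = *-cancelˡ-≡ m n 2 (+-cancelʳ-≡ 1 (2 * m) (2 * n) e) , refl
digit-injective m n l r e =
  ⊥-elim (even≢odd m n (trans (sym (+-identityʳ (2 * m))) (trans e (+-comm (2 * n) 1))))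
digit-injective m n r l e =
  ⊥-elim (even≢odd n m (trans (sym (+-identityʳ (2 * n))) (trans (sym e) (+-comm (2 * m) 1))))

f-injective : ∀ u v → f u ≡ f v → u ≡ v
f-injective u v = along (reverseView u) (reverseView v)
  where
  along : ∀ {u v} → Reverse u → Reverse v → f u ≡ f v → u ≡ v
  along [] [] _ = refl
  along [] (v ∶ _ ∶ʳ b) e = ⊥-elim (0≢1+n (trans e (f-∷ʳ v b)))
  along (u ∶ _ ∶ʳ a) [] e = ⊥-elim (0≢1+n (trans (sym e) (f-∷ʳ u a)))
  along (u ∶ ru ∶ʳ a) (v ∶ rv ∶ʳ b) e
    with fu≡fv , refl ← digit-injective (f u) (f v) a b
                          (suc-injective (trans (sym (f-∷ʳ u a)) (trans e (f-∷ʳ v b))))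
    = cong (_∷ʳ a) (along ru rv fu≡fv)

-- Successor in bijective base 2: the word enumerated right after w.
successor : ∀ {w : Word} → Reverse w → Word
successor []            = l ∷ []
successor (w ∶ _ ∶ʳ l)  = w ∷ʳ r
successor (_ ∶ rw ∶ʳ r) = successor rw ∷ʳ l

f-successor : ∀ {w : Word} (rw : Reverse w) → f (successor rw) ≡ suc (f w)
f-successor [] = refl
f-successor (w ∶ _ ∶ʳ l) = begin
  f (w ∷ʳ r)                ≡⟨ f-∷ʳ w r ⟩
  suc (2 * f w + 1)         ≡⟨ cong suc (+-suc (2 * f w) 0) ⟩
  suc (suc (2 * f w + 0))   ≡⟨ cong suc (sym (f-∷ʳ w l)) ⟩
  suc (f (w ∷ʳ l))          ∎
f-successor (w ∶ rw ∶ʳ r) = begin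
  f (successor rw ∷ʳ l)           ≡⟨ f-∷ʳ (successor rw) l ⟩
  suc (2 * f (successor rw) + 0)  ≡⟨ cong (λ n → suc (2 * n + 0)) (f-successor rw) ⟩
  suc (2 * suc (f w) + 0)         ≡⟨ cong suc (+-identityʳ (2 * suc (f w))) ⟩
  suc (2 * suc (f w))             ≡⟨ cong suc (*-suc 2 (f w)) ⟩
  suc (suc (1 + 2 * f w))         ≡⟨ cong (λ n → suc (suc n)) (+-comm 1 (2 * f w)) ⟩
  suc (suc (2 * f w + 1))         ≡⟨ cong suc (sym (f-∷ʳ w r)) ⟩
  suc (f (w ∷ʳ r))                ∎

f-surjective : ∀ n → ∃[ w ] f w ≡ n
f-surjective zero = [] , refl
f-surjective (suc n) with w , fw≡n ← f-surjective n =
  successor (reverseView w) , trans (f-successor (reverseView w)) (cong suc fw≡n)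

-- The prefix order

≼-reflexive : ∀ {u v} → u ≡ v → u ≼ v
≼-reflexive {u} refl = [] , ++-identityʳ u

≼-trans : ∀ {u v w} → u ≼ v → v ≼ w → u ≼ w
≼-trans {u} (s , refl) (t , refl) = s ++ t , sym (++-assoc u s t)

∷-≼ : ∀ {a u v} → u ≼ v → (a ∷ u) ≼ (a ∷ v)
∷-≼ {a} (s , e) = s , cong (a ∷_) e

≼-common : ∀ {u v w} → u ≼ w → v ≼ w → u ≼ v ⊎ v ≼ u
≼-common {[]}              _        _       = inj₁ (_ , refl)
≼-common {_ ∷ _} {[]}      _        _       = inj₂ (_ , refl)
≼-common {a ∷ u} {b ∷ v} (s , refl) (t , e) with refl ← ∷-injectiveˡ e =
  ⊎-map ∷-≼ ∷-≼ (≼-common (s , refl) (t , ∷-injectiveʳ e))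

≼-cancelˡ : ∀ p {u v} → (p ++ u) ≼ (p ++ v) → u ≼ v
≼-cancelˡ p {u} (s , e) = s , ++-cancelˡ p _ _ (trans (sym (++-assoc p u s)) e)

_≟ᴸ_ : (a b : Letter) → Dec (a ≡ b)
l ≟ᴸ l = yes refl
l ≟ᴸ r = no (λ ())
r ≟ᴸ l = no (λ ())
r ≟ᴸ r = yes refl

_≼?_ : ∀ u v → Dec (u ≼ v)
[]      ≼? v       = yes (v , refl)
(a ∷ u) ≼? []      = no (λ { (_ , ()) })
(a ∷ u) ≼? (b ∷ v) with a ≟ᴸ b
... | no a≢b   = no (λ { (_ , e) → a≢b (∷-injectiveˡ e) })
... | yes refl = map′ ∷-≼ (λ { (s , e) → s , ∷-injectiveʳ e }) (u ≼? v)

branches-incomparable : ∀ p {a d} s t → a ≢ d → Incomparable (p ++ a ∷ s) (p ++ d ∷ t)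
branches-incomparable p s t a≢d =
  (λ le → a≢d (∷-injectiveˡ (proj₂ (≼-cancelˡ p le)))) ,
  (λ ge → a≢d (sym (∷-injectiveˡ (proj₂ (≼-cancelˡ p ge)))))

≼-child : ∀ {w v} → w ≼ v → ¬ v ≼ w → ((w ∷ʳ l) ≼ v) ⊎ ((w ∷ʳ r) ≼ v)
≼-child {w} ([] , e) v⋠w = ⊥-elim (v⋠w (≼-reflexive (trans (sym e) (++-identityʳ w))))
≼-child {w} (l ∷ s , e) _ = inj₁ (s , trans (++-assoc w (l ∷ []) s) e)
≼-child {w} (r ∷ s , e) _ = inj₂ (s , trans (++-assoc w (r ∷ []) s) e)

-- Finite antichains

AntichainOfSize : WordSet → ℕ → Set
AntichainOfSize B k =
  Σ (List Word) λ ws → AllPairs Incomparable ws × All B ws × k ≤ length ws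

Wide : WordSet → Set
Wide B = ∀ k → AntichainOfSize B k

Bounded : WordSet → Set
Bounded B = ∃[ k ] ¬ AntichainOfSize B k

Cone : WordSet → Word → WordSet
Cone B w u = B u × w ≼ u

antichain-mono : ∀ {B C : WordSet} {k} → (∀ {w} → B w → C w) →
                 AntichainOfSize B k → AntichainOfSize C k
antichain-mono B⊆C (ws , anti , ws∈B , k≤) = ws , anti , All.map B⊆C ws∈B , k≤

filter-antichain : ∀ {B : WordSet} {P : Pred Word 0ℓ} (P? : Decidable P) {ws k} →
                   AllPairs Incomparable ws → All B ws → k ≤ length (filter P? ws) →
                   AntichainOfSize (λ u → B u × P u) k
filter-antichain P? {ws} anti ws∈B k≤ =
  filter P? ws , AllPairs.filter⁺ P? anti ,
  All.zip (All.filter⁺ P? ws∈B , All.all-filter P? ws) , k≤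

infinite⇒wide : ∀ {B} → HasInfiniteAntichain B → Wide B
infinite⇒wide (A , A⊆B , anti , g , g-injective) k =
  tabulate word , AllPairs.tabulate⁺ distinct ,
  All.tabulate⁺ (λ i → A⊆B _ (proj₂ (g (toℕ i)))) , ≤-reflexive (sym (length-tabulate word))
  where
  word : Fin k → Word
  word i = proj₁ (g (toℕ i))
  distinct : ∀ {i j} → i ≢ j → Incomparable (word i) (word j)
  distinct {i} {j} i≢j = anti _ _ (proj₂ (g (toℕ i))) (proj₂ (g (toℕ j)))
    (λ e → i≢j (toℕ-injective (g-injective _ _ e)))

bounded⇒no-infinite : ∀ {B} → Bounded B → I B
bounded⇒no-infinite (k , none) inf = none (infinite⇒wide inf k)

I-⊆ : ∀ {B C : WordSet} → (∀ w → C w → B w) → I B → I C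
I-⊆ C⊆B noB (A , A⊆C , rest) = noB (A , (λ w a → C⊆B w (A⊆C w a)) , rest)

length-filter-∪ : ∀ {A : Set} {P Q : Pred A 0ℓ} (P? : Decidable P) (Q? : Decidable Q) xs →
                  All (λ x → P x ⊎ Q x) xs → length xs ≤ length (filter P? xs) + length (filter Q? xs)
length-filter-∪ P? Q? [] [] = z≤n
length-filter-∪ P? Q? (x ∷ xs) (px⊎qx ∷ covered)
  with ih ← length-filter-∪ P? Q? xs covered | P? x | Q? x
... | yes _ | yes _ = s≤s (≤-trans ih (+-monoʳ-≤ _ (n≤1+n _)))
... | yes _ | no _  = s≤s ih
... | no _  | yes _ = ≤-trans (s≤s ih) (≤-reflexive (sym (+-suc _ _)))
... | no ¬p | no ¬q = ⊥-elim ([ ¬p , ¬q ]′ px⊎qx)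

+-≤-split : ∀ {k₁ k₂} a b → k₁ + k₂ ≤ a + b → k₁ ≤ a ⊎ k₂ ≤ b
+-≤-split {k₁} {k₂} a b le with k₁ ≤? a
... | yes k₁≤a = inj₁ k₁≤a
... | no k₁≰a  = inj₂ (+-cancelˡ-≤ k₁ k₂ b (≤-trans le (+-monoˡ-≤ b (<⇒≤ (≰⇒> k₁≰a)))))

-- In an antichain u ∷ vs below w, the tail vs lies below the children of w:
-- no v in vs can be a prefix of w, since it would be a prefix of u.
tail-below-children : ∀ {w u vs} → w ≼ u → All (Incomparable u) vs → All (w ≼_) vs →
                      All (λ v → (w ∷ʳ l) ≼ v ⊎ (w ∷ʳ r) ≼ v) vs
tail-below-children w≼u u#vs w≼vs =
  All.zipWith (λ (u#v , w≼v) → ≼-child w≼v (λ v≼w → proj₂ u#v (≼-trans v≼w w≼u))) (u#vs , w≼vs)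

-- The König-type lemma: wide sets have infinite antichains (classically)

module Classical (em : ExcludedMiddle (lsuc 0ℓ)) where

  em₀ : ExcludedMiddle 0ℓ
  em₀ = map′ lower lift em

  dne : DoubleNegationElimination 0ℓ
  dne = em⇒dne em₀

  wide-or-bounded : ∀ B → Wide B ⊎ Bounded B
  wide-or-bounded B with em₀ {Wide B}
  ... | yes wide = inj₁ wide
  ... | no ¬wide = inj₂ (dne (λ ¬bounded → ¬wide (λ k → dne (λ none → ¬bounded (k , none)))))

  module _ (B : WordSet) where

    -- A wide cone has a wide child cone: an antichain of size 1 + k₁ + k₂ in the
    -- cone at w has a tail of size k₁ + k₂ covered by the two child cones.
    child-wide : ∀ w → Wide (Cone B w) → ∃[ d ] Wide (Cone B (w ∷ʳ d))
    child-wide w wide with wide-or-bounded (Cone B (w ∷ʳ l)) | wide-or-bounded (Cone B (w ∷ʳ r))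
    ... | inj₁ wide-l | _          = l , wide-l
    ... | inj₂ _      | inj₁ wide-r = r , wide-r
    ... | inj₂ (k₁ , none-l) | inj₂ (k₂ , none-r) = too-large (wide (suc (k₁ + k₂)))
      where
      too-large : AntichainOfSize (Cone B w) (suc (k₁ + k₂)) → ∃[ d ] Wide (Cone B (w ∷ʳ d))
      too-large (u ∷ vs , u#vs ∷ anti , (_ , w≼u) ∷ vs∈cone , s≤s k≤|vs|) =
        ⊥-elim ([ (λ k₁≤ → none-l (restrict l k₁≤)) , (λ k₂≤ → none-r (restrict r k₂≤)) ]′
          (+-≤-split _ _ (≤-trans k≤|vs| (length-filter-∪ ((w ∷ʳ l) ≼?_) ((w ∷ʳ r) ≼?_) vs
            (tail-below-children w≼u u#vs (All.map proj₂ vs∈cone))))))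
        where
        restrict : ∀ d {k} → k ≤ length (filter ((w ∷ʳ d) ≼?_) vs) → AntichainOfSize (Cone B (w ∷ʳ d)) k
        restrict d = filter-antichain ((w ∷ʳ d) ≼?_) anti (All.map proj₁ vs∈cone)

    record Split (w : Word) : Set where
      field
        next      : Word
        out       : Word
        w≼next    : w ≼ next
        w≼out     : w ≼ out
        out∈B     : B out
        out#next  : Incomparable out next
        next-wide : Wide (Cone B next)

    split-weaken : ∀ {w p} → w ≼ p → Split p → Split w
    split-weaken w≼p s = record
      { next = next ; out = out ; w≼next = ≼-trans w≼p w≼next ; w≼out = ≼-trans w≼p w≼out
      ; out∈B = out∈B ; out#next = out#next ; next-wide = next-wide }
      where open Split s

    leave : ∀ p {a d} s → a ≢ d → B (p ++ a ∷ s) → Wide (Cone B (p ∷ʳ d)) → Split p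
    leave p {a} {d} s a≢d o∈B wide = record
      { next = p ∷ʳ d ; out = p ++ a ∷ s ; w≼next = d ∷ [] , refl ; w≼out = a ∷ s , refl
      ; out∈B = o∈B ; out#next = branches-incomparable p s [] a≢d ; next-wide = wide }

    -- Two incomparable members u = p s, v = p t of B below a wide node p give a split
    -- at p: follow wide children until the path leaves u or v (it must, by incomparability).
    split-at : ∀ p s t {u v} → p ++ s ≡ u → p ++ t ≡ v →
               Wide (Cone B p) → B u → B v → Incomparable u v → Split p
    split-at p [] t refl refl _ _ _ u#v = ⊥-elim (proj₁ u#v (t , cong (_++ t) (++-identityʳ p)))
    split-at p (a ∷ s) [] refl refl _ _ _ u#v =
      ⊥-elim (proj₂ u#v (a ∷ s , cong (_++ a ∷ s) (++-identityʳ p)))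
    split-at p (a ∷ s) (b ∷ t) refl refl wide u∈B v∈B u#v
      with d , wide-d ← child-wide p wide | a ≟ᴸ d | b ≟ᴸ d
    ... | no a≢d | _        = leave p s a≢d u∈B wide-d
    ... | yes _  | no b≢d   = leave p t b≢d v∈B wide-d
    ... | yes refl | yes refl =
      split-weaken (a ∷ [] , refl)
        (split-at (p ∷ʳ a) s t (++-assoc p (a ∷ []) s) (++-assoc p (a ∷ []) t) wide-d u∈B v∈B u#v)

    split : ∀ w → Wide (Cone B w) → Split w
    split w wide with wide 2
    ... | [] , _ , _ , ()
    ... | _ ∷ [] , _ , _ , s≤s ()
    ... | _ ∷ _ ∷ _ , (u#v ∷ _) ∷ _ , (u∈B , s , refl) ∷ (v∈B , t , refl) ∷ _ , _ =
      split-at w s t refl refl wide u∈B v∈B u#v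

    -- Iterating splits from a wide root gives nodes node 0 ≼ node 1 ≼ ⋯ and
    -- elements out n ≽ node n incomparable with node (n + 1); these form an antichain.
    module Iterate (root-wide : Wide (Cone B [])) where

      nodes : ℕ → Σ Word (λ w → Wide (Cone B w))
      nodes zero    = [] , root-wide
      nodes (suc n) = let s = split (proj₁ (nodes n)) (proj₂ (nodes n)) in
                      Split.next s , Split.next-wide s

      node : ℕ → Word
      node n = proj₁ (nodes n)

      splitₙ : ∀ n → Split (node n)
      splitₙ n = split (node n) (proj₂ (nodes n))

      out : ℕ → Word
      out n = Split.out (splitₙ n)

      node-mono : ∀ i {j} → i ≤′ j → node i ≼ node j
      node-mono i ≤′-refl          = ≼-reflexive refl
      node-mono i (≤′-step {j} i≤′j) = ≼-trans (node-mono i i≤′j) (Split.w≼next (splitₙ j))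

      -- out j extends node (i + 1), which is incomparable with out i.
      out-incomparable : ∀ i j → i < j → Incomparable (out i) (out j)
      out-incomparable i j i<j =
        (λ oi≼oj → [ proj₁ oi#next , proj₂ oi#next ]′ (≼-common oi≼oj next≼oj)) ,
        (λ oj≼oi → proj₂ oi#next (≼-trans next≼oj oj≼oi))
        where
        oi#next : Incomparable (out i) (node (suc i))
        oi#next = Split.out#next (splitₙ i)
        next≼oj : node (suc i) ≼ out j
        next≼oj = ≼-trans (node-mono (suc i) (≤⇒≤′ i<j)) (Split.w≼out (splitₙ j))

      distinct-incomparable : ∀ i j → i ≢ j → Incomparable (out i) (out j)
      distinct-incomparable i j i≢j with <-cmp i j
      ... | tri< i<j _ _ = out-incomparable i j i<j
      ... | tri≈ _ i≡j _ = ⊥-elim (i≢j i≡j)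
      ... | tri> _ _ j<i = swap (out-incomparable j i j<i)

      infinite : HasInfiniteAntichain B
      infinite = (λ u → ∃[ n ] out n ≡ u) , (λ { _ (n , refl) → Split.out∈B (splitₙ n) }) ,
                 antichain , (λ n → out n , n , refl) , injective
        where
        antichain : IsAntichain (λ u → ∃[ n ] out n ≡ u)
        antichain _ _ (i , refl) (j , refl) u≢v = distinct-incomparable i j (λ i≡j → u≢v (cong out i≡j))
        injective : ∀ i j → out i ≡ out j → i ≡ j
        injective i j e with i ≟ j
        ... | yes i≡j = i≡j
        ... | no i≢j  = ⊥-elim (proj₁ (distinct-incomparable i j i≢j) (≼-reflexive e))

    wide⇒infinite : Wide B → HasInfiniteAntichain B
    wide⇒infinite wide = Iterate.infinite (λ k → antichain-mono (λ u∈B → u∈B , _ , refl) (wide k))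

  no-infinite⇔bounded : ∀ B → I B ⇔ Bounded B
  no-infinite⇔bounded B = mk⇔
    (λ noInf → [ (λ wide → ⊥-elim (noInf (wide⇒infinite B wide))) , id ]′ (wide-or-bounded B))
    bounded⇒no-infinite

-- Decoding Cantor points; the closed sets Cₖ

decode : Cantor → WordSet
decode x w = x (f w) ≡ true

-- x codes f[decode x], because f is onto.
codes-decode : ∀ x → Codes x (image (decode x))
codes-decode x n = mk⇔
  (λ xn → let (w , fw≡n) = f-surjective n in w , subst (λ m → x m ≡ true) (sym fw≡n) xn , fw≡n)
  (λ { (w , xfw , fw≡n) → subst (λ m → x m ≡ true) fw≡n xfw })

-- If x codes f[B] then decode x ⊆ B, because f is injective.
decode-⊆ : ∀ {x B} → Codes x (image B) → ∀ w → decode x w → B w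
decode-⊆ {B = B} codes w xfw with w′ , w′∈B , fw′≡fw ← Equivalence.to (codes (f w)) xfw =
  subst B (f-injective w′ w fw′≡fw) w′∈B

fI⇔I-decode : ∀ x → fI x ⇔ I (decode x)
fI⇔I-decode x = mk⇔
  (λ { (B , noInf , codes) → I-⊆ (decode-⊆ codes) noInf })
  (λ noInf → decode x , noInf , codes-decode x)

C : ℕ → Cantor → Set₁
C k x = Lift (lsuc 0ℓ) (¬ AntichainOfSize (decode x) k)

bounded⇔C : ∀ x → Bounded (decode x) ⇔ (∃[ k ] C k x)
bounded⇔C x = mk⇔ (λ { (k , none) → k , lift none }) (λ { (k , lift none) → k , none })

bound : List Word → ℕ
bound []       = 0
bound (w ∷ ws) = suc (f w) + bound ws

below-bound : ∀ ws → All (λ w → f w < bound ws) ws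
below-bound [] = []
below-bound (w ∷ ws) = m≤m+n (suc (f w)) (bound ws) ∷
  All.map (λ lt → ≤-trans lt (m≤n+m (bound ws) (suc (f w)))) (below-bound ws)

decode-stable : ∀ {x y} ws → Agree (bound ws) x y → All (decode x) ws → All (decode y) ws
decode-stable ws agree ws∈ =
  All.zipWith (λ (lt , xfw) → trans (agree _ lt) xfw) (below-bound ws , ws∈)

-- Cₖ is closed: a k-element antichain in decode x persists near x.
C-closed : DoubleNegationElimination 0ℓ → ∀ k → IsClosed (C k)
C-closed dne k x notC with ws , anti , ws∈ , k≤ ← dne (λ none → notC (lift none)) =
  bound ws , λ y agree Cy → lower Cy (ws , anti , decode-stable ws agree ws∈ , k≤)

proposition4p8 : ExcludedMiddle (lsuc 0ℓ) → IsFσ fI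
proposition4p8 em = C , C-closed dne , λ x →
  ⇔-trans (fI⇔I-decode x) (⇔-trans (no-infinite⇔bounded (decode x)) (bounded⇔C x))
  where open Classical em
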